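{- Let $p \ne 2,5$ be prime and let $|\alpha|$ denote the order of the reduction of $\alpha = (3/2,1/2)$ in $G(\mathbb{F}_p)$. Then \[ Z(p) = \begin{cases} 2|\alpha| & \text{if } |\alpha| \text{ is odd},\\ \tfrac12 |\alpha| & \text{if } |\alpha| \equiv 2 \pmod 4,\\ |\alpha| & \text{if } |\alpha| \equiv 0 \pmod 4.\end{cases} \]
   Context: For a field $K$, $G(K) = \{(x,y)\in K^2 : x^2 - 5y^2 = 1\}$ with the group law $(x_1,y_1)*(x_2,y_2) = (x_1x_2 + 5y_1y_2,\, x_1y_2 + x_2y_1)$ and identity $(1,0)$. For $p\neq 2$, $(3/2,1/2)$ reduces to a point of $G(\mathbb{F}_p)$. $Z(p)$ is the smallest positive integer $n$ with $p \mid F_n$, where $F_n$ is the Fibonacci sequence ($F_0=0$, $F_1=1$, $F_n=F_{n-1}+F_{n-2}$). -}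

module Defs where

open import Data.Nat using (ℕ; zero; suc; _+_; _*_; _<_; NonZero)
open import Data.Nat.DivMod using (_%_; _/_)
open import Data.Nat.Divisibility using (_∣_)
open import Data.Product using (_×_; _,_)
open import Relation.Nullary using (¬_)
open import Relation.Binary.PropositionalEquality using (_≡_; _≢_)

F : ℕ → ℕ
F zero = 0
F (suc zero) = 1
F (suc (suc n)) = F (suc n) + F n

IsZ : ℕ → ℕ → Set
IsZ p n = (0 < n) × (p ∣ F n) × (∀ m → 0 < m → m < n → ¬ (p ∣ F m))

-- Elements of F_p are represented by their residues in {0,…,p-1}.
-- Points of G(F_p) are pairs of residues.
Pt : Set
Pt = ℕ × ℕ

mul : (p : ℕ) → .{{_ : NonZero p}} → Pt → Pt → Pt
mul p (x₁ , y₁) (x₂ , y₂) = ((x₁ * x₂ + 5 * (y₁ * y₂)) % p , (x₁ * y₂ + x₂ * y₁) % p)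

one : (p : ℕ) → .{{_ : NonZero p}} → Pt
one p = (1 % p , 0)

-- inverse of 2 in F_p for odd p: (p+1)/2
half : ℕ → ℕ
half p = (p + 1) / 2

α : (p : ℕ) → .{{_ : NonZero p}} → Pt
α p = ((3 * half p) % p , half p % p)

pow : (p : ℕ) → .{{_ : NonZero p}} → Pt → ℕ → Pt
pow p a zero = one p
pow p a (suc n) = mul p (pow p a n) a

IsOrder : (p : ℕ) → .{{_ : NonZero p}} → ℕ → Set
IsOrder p n = (0 < n) × (pow p (α p) n ≡ one p)
            × (∀ m → 0 < m → m < n → pow p (α p) m ≢ one p)

module Submission where

-- The order of α = (3/2, 1/2) in G(F_p) against the Fibonacci rank of apparition
-- Z p, for an odd prime p.  In F_p(√5), α corresponds to φ² = (3 + √5)/2.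
--
-- 1. With h = (p + 1)/2 (the inverse of 2) and L the Lucas numbers,
--    αⁿ = (h L (2n), h F (2n)) mod p, so αⁿ = 1 iff F (2n) ≡ 0 and
--    F (2n + 1) ≡ 1 (modules PowersOfα and IdentityCriterion).
-- 2. Let z = Z p and c = F (z - 1).  The addition formula gives F (n + j z) ≡ cʲ F n
--    and Cassini gives c² ≡ (-1)ᶻ, so c is a unit.  Hence p ∣ F n iff z ∣ n, and
--    αⁿ = 1 iff 2n = j z with cʲ ≡ 1 (module Zeros).
-- 3. If c has multiplicative order e and e z = 2m, then αⁿ = 1 iff m ∣ n, so the
--    order of α is m (order-of-α).
-- 4. z odd: c² ≡ -1, e = 4 and |α| = 2z ≡ 2 (mod 4).  z = 2k: F (2k) = F k L k and
--    Euclid's lemma give L k ≡ 0, whence c ≡ (-1)ᵏ⁻¹; k odd gives e = 1 and |α| = k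
--    odd, k even gives e = 2 and |α| = z ≡ 0 (mod 4).  Reading z off |α| in each
--    residue class is the theorem.

open import Defs

open import Data.Nat using (ℕ; zero; suc; NonZero; z<s; _<_)
import Data.Nat as Nat
open import Data.Nat.Primality using (Prime)
open import Data.Integer using (ℤ)
open import Data.Product using (Σ; _,_; proj₁; proj₂; _×_)
open import Data.Empty using (⊥-elim)
open import Function using (_∘_)
open import Relation.Nullary using (¬_)
open import Relation.Binary.PropositionalEquality

-- In the Lucas identities, after one case
-- split the recurrence unfolds both sides definitionally into the same polynomial
-- in F (n + 1) and F n, which the ring solver then compares.
module FibonacciIdentities where
  open Nat using (_+_; _*_)
  open import Data.Nat.Properties using (+-suc)
  open import Data.Nat.Tactic.RingSolver using (solve-∀)

  L : ℕ → ℕ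
  L zero = 2
  L (suc n) = F n + F (suc (suc n))

  lucas-fib : ∀ n → L n + F n ≡ 2 * F (suc n)
  lucas-fib zero = refl
  lucas-fib (suc n) = poly (F (suc n)) (F n)
    where
    poly : ∀ a b → (b + (a + b)) + a ≡ 2 * (a + b)
    poly = solve-∀

  -- 2 L (n + 2) = 3 L n + 5 F n and 2 F (n + 2) = L n + 3 F n: multiplying
  -- (L n + F n √5) / 2 by (3 + √5) / 2.
  lucas-step : ∀ n → 2 * L (suc (suc n)) ≡ 3 * L n + 5 * F n
  lucas-step zero = refl
  lucas-step (suc n) = poly (F (suc n)) (F n)
    where
    poly : ∀ a b → 2 * ((a + b) + (((a + b) + a) + (a + b))) ≡ 3 * (b + (a + b)) + 5 * a
    poly = solve-∀

  fib-step : ∀ n → 2 * F (suc (suc n)) ≡ L n + 3 * F n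
  fib-step zero = refl
  fib-step (suc n) = poly (F (suc n)) (F n)
    where
    poly : ∀ a b → 2 * ((a + b) + a) ≡ (b + (a + b)) + 3 * a
    poly = solve-∀

  fib-add : ∀ m n → F (suc (m + n)) ≡ F (suc m) * F (suc n) + F m * F n
  fib-add zero n = poly (F (suc n)) (F n)
    where
    poly : ∀ a b → a ≡ 1 * a + 0 * b
    poly = solve-∀
  fib-add (suc m) n = begin
    F (suc (suc (m + n)))                             ≡⟨ cong (F ∘ suc) (sym (+-suc m n)) ⟩
    F (suc (m + suc n))                               ≡⟨ fib-add m (suc n) ⟩
    F (suc m) * F (suc (suc n)) + F m * F (suc n)     ≡⟨ poly (F (suc m)) (F m) (F (suc n)) (F n) ⟩
    F (suc (suc m)) * F (suc n) + F (suc m) * F n     ∎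
    where
    open ≡-Reasoning
    poly : ∀ a b c d → a * (c + d) + b * c ≡ (a + b) * c + a * d
    poly = solve-∀

  fib-double : ∀ k → F (k + k) ≡ F k * L k
  fib-double zero = refl
  fib-double (suc k) = begin
    F (suc k + suc k)                      ≡⟨ cong F (+-suc (suc k) k) ⟩
    F (suc (suc k + k))                    ≡⟨ fib-add (suc k) k ⟩
    F (suc (suc k)) * F (suc k) + F (suc k) * F k   ≡⟨ poly (F (suc (suc k))) (F (suc k)) (F k) ⟩
    F (suc k) * L (suc k)                  ∎
    where
    open ≡-Reasoning
    poly : ∀ w u v → w * u + u * v ≡ u * (v + w)
    poly = solve-∀

open FibonacciIdentities

module IntegerFibonacci where
  open import Data.Integer using (+_; _+_; _*_; _-_; _^_; 1ℤ; -1ℤ)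
  open import Data.Integer.Properties using (pos-+; pos-*)
  open import Data.Integer.Tactic.RingSolver using (solve-∀)

  f : ℕ → ℤ
  f n = + F n

  f-add : ∀ m n → f (suc (m Nat.+ n)) ≡ f (suc m) * f (suc n) + f m * f n
  f-add m n = trans (cong +_ (fib-add m n))
    (trans (pos-+ (F (suc m) Nat.* F (suc n)) (F m Nat.* F n))
      (cong₂ _+_ (pos-* (F (suc m)) (F (suc n))) (pos-* (F m) (F n))))

  cassini : ∀ n → f (suc n) * f (suc n) - f n * f (suc (suc n)) ≡ -1ℤ ^ n
  cassini zero = refl
  cassini (suc n) = trans (poly (f (suc n)) (f n)) (cong (-1ℤ *_) (cassini n))
    where
    poly : ∀ a b → (a + b) * (a + b) - a * ((a + b) + a) ≡ -1ℤ * (a * a - b * (a + b))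
    poly = solve-∀

  sign-even : ∀ k → -1ℤ ^ (k Nat.+ k) ≡ 1ℤ
  sign-even zero = refl
  sign-even (suc k) = begin
    -1ℤ ^ suc (k Nat.+ suc k)           ≡⟨ cong (λ t → -1ℤ ^ suc t) (+-suc k k) ⟩
    -1ℤ * (-1ℤ * -1ℤ ^ (k Nat.+ k))      ≡⟨ poly (-1ℤ ^ (k Nat.+ k)) ⟩
    -1ℤ ^ (k Nat.+ k)                    ≡⟨ sign-even k ⟩
    1ℤ                                 ∎
    where
    open ≡-Reasoning
    open import Data.Nat.Properties using (+-suc)
    poly : ∀ x → -1ℤ * (-1ℤ * x) ≡ x
    poly = solve-∀

  sign-odd : ∀ k → -1ℤ ^ suc (k Nat.+ k) ≡ -1ℤ
  sign-odd k = cong (-1ℤ *_) (sign-even k)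

  sign-square : ∀ n → -1ℤ ^ n * -1ℤ ^ n ≡ 1ℤ
  sign-square n = trans (sym (^-distribˡ-+-* -1ℤ n n)) (sign-even n)
    where open import Data.Integer.Properties using (^-distribˡ-+-*)

open IntegerFibonacci

module Periods where
  open Nat using (_+_; _*_; _≤_)
  open import Data.Nat.DivMod using (_%_; _/_; m≡m%n+[m/n]*n; m%n<n)
  open import Data.Nat.Divisibility using (_∣_; m%n≡0⇒n∣m; ∣⇒≤)
  open import Data.Nat.Properties using (≤-antisym; ≮⇒≥)

  multiples-of-period : (S : ℕ → Set) (e : ℕ) .{{_ : NonZero e}}
    → (∀ r q → S (r + q * e) → S r) → (∀ r → 0 < r → r < e → ¬ S r)
    → ∀ n → S n → e ∣ n
  multiples-of-period S e strip gap n Sn =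
    m%n≡0⇒n∣m n e (remainder-zero (n % e) (m%n<n n e)
      (strip (n % e) (n / e) (subst S (m≡m%n+[m/n]*n n e) Sn)))
    where
    remainder-zero : ∀ r → r < e → S r → r ≡ 0
    remainder-zero zero _ _ = refl
    remainder-zero (suc r) r<e Sr = ⊥-elim (gap (suc r) z<s r<e Sr)

  least-positive-solution : (S : ℕ → Set) (m : ℕ) → 0 < m → S m → (∀ n → S n → m ∣ n)
    → ∀ a → 0 < a → S a → (∀ k → 0 < k → k < a → ¬ S k) → a ≡ m
  least-positive-solution S m m>0 Sm multiple a a>0 Sa minimal =
    ≤-antisym (≮⇒≥ (λ m<a → minimal m m>0 m<a Sm)) (m≤a a>0)
    where
    m≤a : 0 < a → m ≤ a
    m≤a z<s = ∣⇒≤ (multiple a Sa)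

module Congruence (P : ℤ) where
  open import Data.Integer using (_+_; _*_; -_; _-_; _^_; 0ℤ; 1ℤ)
  open import Data.Integer.Divisibility.Signed
    using (divides; ∣m∣n⇒∣m+n; ∣m⇒∣-m; ∣m⇒∣m*n; ∣n⇒∣m*n) renaming (_∣_ to _∣ℤ_)
  open import Data.Integer.Properties using (^-distribˡ-+-*; ^-*-assoc; ^-zeroˡ; *-identityʳ)
  open import Data.Integer.Tactic.RingSolver using (solve-∀)
  open import Data.Nat.Divisibility using (_∣_)
  open import Data.Nat.Properties using (*-comm)
  open Periods using (multiples-of-period)
  open import Relation.Binary.Bundles using (Setoid)
  import Relation.Binary.Reasoning.Setoid as SetoidReasoning

  infix 4 _≋_
  record _≋_ (x y : ℤ) : Set where
    constructor by-divisibility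
    field divisible : P ∣ℤ x - y
  open _≋_ public

  private
    via : ∀ {x y u} → x - y ≡ u → P ∣ℤ u → x ≋ y
    via e d = by-divisibility (subst (P ∣ℤ_) (sym e) d)

  ≋-refl : ∀ {x} → x ≋ x
  ≋-refl {x} = via (poly x P) (divides 0ℤ refl)
    where
    poly : ∀ x P → x - x ≡ 0ℤ * P
    poly = solve-∀

  ≡⇒≋ : ∀ {x y} → x ≡ y → x ≋ y
  ≡⇒≋ refl = ≋-refl

  ≋-sym : ∀ {x y} → x ≋ y → y ≋ x
  ≋-sym {x} {y} d = via (poly x y) (∣m⇒∣-m (divisible d))
    where
    poly : ∀ x y → y - x ≡ - (x - y)
    poly = solve-∀

  ≋-trans : ∀ {x y z} → x ≋ y → y ≋ z → x ≋ z
  ≋-trans {x} {y} {z} d e = via (poly x y z) (∣m∣n⇒∣m+n (divisible d) (divisible e))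
    where
    poly : ∀ x y z → x - z ≡ (x - y) + (y - z)
    poly = solve-∀

  +-cong : ∀ {a b c d} → a ≋ b → c ≋ d → a + c ≋ b + d
  +-cong {a} {b} {c} {d} e e' = via (poly a b c d) (∣m∣n⇒∣m+n (divisible e) (divisible e'))
    where
    poly : ∀ a b c d → (a + c) - (b + d) ≡ (a - b) + (c - d)
    poly = solve-∀

  *-cong : ∀ {a b c d} → a ≋ b → c ≋ d → a * c ≋ b * d
  *-cong {a} {b} {c} {d} e e' = via (poly a b c d) (∣m∣n⇒∣m+n (∣n⇒∣m*n a (divisible e')) (∣m⇒∣m*n d (divisible e)))
    where
    poly : ∀ a b c d → a * c - b * d ≡ a * (c - d) + (a - b) * d
    poly = solve-∀

  ^-cong : ∀ {a b} n → a ≋ b → a ^ n ≋ b ^ n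
  ^-cong zero _ = ≋-refl
  ^-cong (suc n) e = *-cong e (^-cong n e)

  ≋-setoid : Setoid _ _
  ≋-setoid = record
    { Carrier = ℤ ; _≈_ = _≋_
    ; isEquivalence = record { refl = ≋-refl ; sym = ≋-sym ; trans = ≋-trans } }

  module ≋-Reasoning = SetoidReasoning ≋-setoid

  open ≋-Reasoning

  +-zeroˡ-≋ : ∀ {a x} → a ≋ 0ℤ → a + x ≋ x
  +-zeroˡ-≋ {a} {x} e = begin
    a + x    ≈⟨ +-cong e (≋-refl {x}) ⟩
    0ℤ + x   ≡⟨ poly x ⟩
    x        ∎
    where
    poly : ∀ x → 0ℤ + x ≡ x
    poly = solve-∀

  *-zeroˡ-≋ : ∀ {a x} → a ≋ 0ℤ → a * x ≋ 0ℤ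
  *-zeroˡ-≋ {a} {x} e = begin
    a * x    ≈⟨ *-cong e (≋-refl {x}) ⟩
    0ℤ * x   ≡⟨ poly x ⟩
    0ℤ       ∎
    where
    poly : ∀ x → 0ℤ * x ≡ 0ℤ
    poly = solve-∀

  unit-cancel : ∀ u v {x} → v * u ≋ 1ℤ → u * x ≋ 0ℤ → x ≋ 0ℤ
  unit-cancel u v {x} vu≋1 ux≋0 = begin
    x              ≡⟨ poly₁ x ⟩
    1ℤ * x         ≈⟨ *-cong (≋-sym vu≋1) (≋-refl {x}) ⟩
    v * u * x      ≡⟨ poly₂ v u x ⟩
    v * (u * x)    ≈⟨ *-cong (≋-refl {v}) ux≋0 ⟩
    v * 0ℤ         ≡⟨ poly₃ v ⟩
    0ℤ             ∎
    where
    poly₁ : ∀ x → x ≡ 1ℤ * x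
    poly₁ = solve-∀
    poly₂ : ∀ v u x → v * u * x ≡ v * (u * x)
    poly₂ = solve-∀
    poly₃ : ∀ v → v * 0ℤ ≡ 0ℤ
    poly₃ = solve-∀

  unit-^ : ∀ u v n → v * u ≋ 1ℤ → v ^ n * u ^ n ≋ 1ℤ
  unit-^ u v zero _ = ≋-refl
  unit-^ u v (suc n) vu≋1 = begin
    v * v ^ n * (u * u ^ n)       ≡⟨ poly v u (v ^ n) (u ^ n) ⟩
    (v * u) * (v ^ n * u ^ n)     ≈⟨ *-cong vu≋1 (unit-^ u v n vu≋1) ⟩
    1ℤ * 1ℤ                       ≡⟨⟩
    1ℤ                            ∎
    where
    poly : ∀ v u a b → v * a * (u * b) ≡ (v * u) * (a * b)
    poly = solve-∀

  order-divides : ∀ u e .{{_ : NonZero e}} → u ^ e ≋ 1ℤ → (∀ r → 0 < r → r < e → ¬ u ^ r ≋ 1ℤ)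
    → ∀ j → u ^ j ≋ 1ℤ → e ∣ j
  order-divides u e uᵉ≋1 gap = multiples-of-period (λ j → u ^ j ≋ 1ℤ) e strip gap
    where
    strip : ∀ r q → u ^ (r Nat.+ q Nat.* e) ≋ 1ℤ → u ^ r ≋ 1ℤ
    strip r q u^[r+qe]≋1 = ≋-trans (≋-sym (begin
      u ^ (r Nat.+ q Nat.* e)     ≡⟨ ^-distribˡ-+-* u r (q Nat.* e) ⟩
      u ^ r * u ^ (q Nat.* e)     ≡⟨ cong (λ t → u ^ r * u ^ t) (*-comm q e) ⟩
      u ^ r * u ^ (e Nat.* q)     ≡⟨ cong (u ^ r *_) (^-*-assoc u e q) ⟨
      u ^ r * (u ^ e) ^ q         ≈⟨ *-cong (≋-refl {u ^ r}) (^-cong q uᵉ≋1) ⟩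
      u ^ r * 1ℤ ^ q              ≡⟨ cong (u ^ r *_) (^-zeroˡ q) ⟩
      u ^ r * 1ℤ                  ≡⟨ *-identityʳ (u ^ r) ⟩
      u ^ r                       ∎)) u^[r+qe]≋1

module Residues (p : ℕ) .{{_ : NonZero p}} where
  open import Data.Nat.DivMod using (_%_; _/_; %-distribˡ-+; %-distribˡ-*; m≡m%n+[m/n]*n; [m+kn]%n≡m%n)
  open import Data.Nat.Divisibility using (_∣_)
  open import Data.Integer using (+_; -[1+_]; _+_; _*_; -_; _-_; 0ℤ)
  open import Data.Integer.Properties using (pos-+; pos-*; +-injective; +-identityʳ)
  open import Data.Integer.Divisibility.Signed as Signed using (divides; ∣ᵤ⇒∣; ∣⇒∣ᵤ)
  open import Data.Integer.Tactic.RingSolver using (solve-∀)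
  open Congruence (+ p) public

  +-mod : ∀ {a b c d} → a % p ≡ b % p → c % p ≡ d % p → (a Nat.+ c) % p ≡ (b Nat.+ d) % p
  +-mod {a} {b} {c} {d} e e' = trans (%-distribˡ-+ a c p)
    (trans (cong₂ (λ s t → (s Nat.+ t) % p) e e') (sym (%-distribˡ-+ b d p)))

  *-mod : ∀ {a b c d} → a % p ≡ b % p → c % p ≡ d % p → (a Nat.* c) % p ≡ (b Nat.* d) % p
  *-mod {a} {b} {c} {d} e e' = trans (%-distribˡ-* a c p)
    (trans (cong₂ (λ s t → (s Nat.* t) % p) e e') (sym (%-distribˡ-* b d p)))

  multiple-apart : ∀ x y k → + x - + y ≡ + k * + p → x % p ≡ y % p
  multiple-apart x y k e = trans (cong (_% p) (+-injective x≡)) ([m+kn]%n≡m%n y k p)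
    where
    open ≡-Reasoning
    poly : ∀ x y → x ≡ y + (x - y)
    poly = solve-∀
    x≡ : + x ≡ + (y Nat.+ k Nat.* p)
    x≡ = begin
      + x                     ≡⟨ poly (+ x) (+ y) ⟩
      + y + (+ x - + y)       ≡⟨ cong (λ t → + y + t) e ⟩
      + y + + k * + p         ≡⟨ cong (λ t → + y + t) (pos-* k p) ⟨
      + y + + (k Nat.* p)     ≡⟨ pos-+ y (k Nat.* p) ⟨
      + (y Nat.+ k Nat.* p)   ∎

  ≋⇒%≡ : ∀ {x y} → + x ≋ + y → x % p ≡ y % p
  ≋⇒%≡ {x} {y} (by-divisibility (divides (+ k) e)) = multiple-apart x y k e
  ≋⇒%≡ {x} {y} (by-divisibility (divides -[1+ k ] e)) =
    sym (multiple-apart y x (suc k) (trans (poly₁ (+ x) (+ y)) (trans (cong -_ e) (poly₂ (+ suc k) (+ p)))))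
    where
    poly₁ : ∀ x y → y - x ≡ - (x - y)
    poly₁ = solve-∀
    poly₂ : ∀ q P → - (- q * P) ≡ q * P
    poly₂ = solve-∀

  %-≋ : ∀ x → + (x % p) ≋ + x
  %-≋ x = ≋-sym (by-divisibility (divides (+ (x / p)) eq))
    where
    r = x % p
    q = x / p
    poly : ∀ a b → (a + b) - a ≡ b
    poly = solve-∀
    eq : + x - + r ≡ + q * + p
    eq = trans (cong (λ t → + t - + r) (m≡m%n+[m/n]*n x p))
      (trans (cong (_- + r) (trans (pos-+ r (q Nat.* p)) (cong (λ t → + r + t) (pos-* q p))))
        (poly (+ r) (+ q * + p)))

  %≡⇒≋ : ∀ {x y} → x % p ≡ y % p → + x ≋ + y
  %≡⇒≋ {x} {y} e = ≋-trans (≋-sym (%-≋ x)) (≋-trans (≡⇒≋ (cong +_ e)) (%-≋ y))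

  ∣⇒≋0 : ∀ {x} → p ∣ x → + x ≋ 0ℤ
  ∣⇒≋0 {x} d = by-divisibility (subst (+ p Signed.∣_) (sym (+-identityʳ (+ x))) (∣ᵤ⇒∣ d))

  ≋0⇒∣ : ∀ {x} → + x ≋ 0ℤ → p ∣ x
  ≋0⇒∣ {x} e = ∣⇒∣ᵤ (subst (+ p Signed.∣_) (+-identityʳ (+ x)) (divisible e))

-- The powers of α modulo an odd p, where h = half p is the inverse of 2.
-- In ℤ[√5], α = ((3 + √5)/2) and ((L k + F k √5)/2)·α = (L (k+2) + F (k+2) √5)/2,
-- hence αⁿ = (h L (2n), h F (2n)) modulo p.
module PowersOfα (p : ℕ) .{{_ : NonZero p}} (two-half : 2 Nat.* half p ≡ p Nat.+ 1) where
  open Nat using (_+_; _*_)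
  open import Data.Nat.DivMod using (_%_; m%n%n≡m%n; [m+kn]%n≡m%n; [m+n]%n≡m%n; m*n%n≡0)
  open import Data.Nat.Properties using (*-comm; +-comm; *-zeroʳ; *-suc)
  open import Data.Nat.Tactic.RingSolver using (solve-∀)
  open Residues p using (+-mod; *-mod)
  open ≡-Reasoning

  h : ℕ
  h = half p

  -- Multiplying by 2h = p + 1 does not change a residue.
  halving : ∀ x → (h * h * (2 * x)) % p ≡ (h * x) % p
  halving x = trans (cong (_% p) (begin
    h * h * (2 * x)        ≡⟨ poly₁ h x ⟩
    (2 * h) * (h * x)      ≡⟨ cong (_* (h * x)) two-half ⟩
    (p + 1) * (h * x)      ≡⟨ poly₂ p (h * x) ⟩
    h * x + (h * x) * p    ∎)) ([m+kn]%n≡m%n (h * x) (h * x) p)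
    where
    poly₁ : ∀ h x → h * h * (2 * x) ≡ (2 * h) * (h * x)
    poly₁ = solve-∀
    poly₂ : ∀ p y → (p + 1) * y ≡ y + y * p
    poly₂ = solve-∀

  mul-residues : ∀ x₁ y₁ x₂ y₂ →
    mul p (x₁ % p , y₁ % p) (x₂ % p , y₂ % p) ≡ mul p (x₁ , y₁) (x₂ , y₂)
  mul-residues x₁ y₁ x₂ y₂ = cong₂ _,_
    (+-mod (*-mod (r x₁) (r x₂)) (*-mod {5} refl (*-mod (r y₁) (r y₂))))
    (+-mod (*-mod (r x₁) (r y₂)) (*-mod (r x₂) (r y₁)))
    where
    r : ∀ x → x % p % p ≡ x % p
    r x = m%n%n≡m%n x p

  α-power : ∀ n → pow p (α p) n ≡ ((h * L (2 * n)) % p , (h * F (2 * n)) % p)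
  α-power zero = cong₂ _,_ (sym one-coordinate) (sym zero-coordinate)
    where
    one-coordinate : (h * 2) % p ≡ 1 % p
    one-coordinate = trans (cong (_% p) (trans (*-comm h 2) (trans two-half (+-comm p 1))))
                           ([m+n]%n≡m%n 1 p)
    zero-coordinate : (h * 0) % p ≡ 0
    zero-coordinate = trans (cong (_% p) (*-zeroʳ h)) (m*n%n≡0 0 p)
  α-power (suc n) = begin
    mul p (pow p (α p) n) (α p)
      ≡⟨ cong (λ q → mul p q (α p)) (α-power n) ⟩
    mul p ((h * L k) % p , (h * F k) % p) ((3 * h) % p , h % p)
      ≡⟨ mul-residues (h * L k) (h * F k) (3 * h) h ⟩
    ((h * L k * (3 * h) + 5 * (h * F k * h)) % p , (h * L k * h + 3 * h * (h * F k)) % p)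
      ≡⟨ cong₂ _,_ x-step y-step ⟩
    ((h * L (2 + k)) % p , (h * F (2 + k)) % p)
      ≡⟨ cong (λ t → ((h * L t) % p , (h * F t) % p)) (sym (*-suc 2 n)) ⟩
    ((h * L (2 * suc n)) % p , (h * F (2 * suc n)) % p) ∎
    where
    k = 2 * n
    poly₁ : ∀ h l f → h * l * (3 * h) + 5 * (h * f * h) ≡ h * h * (3 * l + 5 * f)
    poly₁ = solve-∀
    poly₂ : ∀ h l f → h * l * h + 3 * h * (h * f) ≡ h * h * (l + 3 * f)
    poly₂ = solve-∀
    x-step : (h * L k * (3 * h) + 5 * (h * F k * h)) % p ≡ (h * L (2 + k)) % p
    x-step = begin
      (h * L k * (3 * h) + 5 * (h * F k * h)) % p  ≡⟨ cong (_% p) (poly₁ h (L k) (F k)) ⟩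
      (h * h * (3 * L k + 5 * F k)) % p            ≡⟨ cong (λ t → (h * h * t) % p) (lucas-step k) ⟨
      (h * h * (2 * L (2 + k))) % p                ≡⟨ halving (L (2 + k)) ⟩
      (h * L (2 + k)) % p                          ∎
    y-step : (h * L k * h + 3 * h * (h * F k)) % p ≡ (h * F (2 + k)) % p
    y-step = begin
      (h * L k * h + 3 * h * (h * F k)) % p        ≡⟨ cong (_% p) (poly₂ h (L k) (F k)) ⟩
      (h * h * (L k + 3 * F k)) % p                ≡⟨ cong (λ t → (h * h * t) % p) (fib-step k) ⟨
      (h * h * (2 * F (2 + k))) % p                ≡⟨ halving (F (2 + k)) ⟩
      (h * F (2 + k)) % p                          ∎

-- αⁿ = 1 modulo p exactly when F (2n) ≡ 0 and F (2n + 1) ≡ 1: the coordinates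
-- (h L k, h F k) are (1, 0) iff (F k, F (k + 1)) = (0, 1), as L k + F k = 2 F (k + 1).
module IdentityCriterion (p : ℕ) .{{_ : NonZero p}} (two-half : 2 Nat.* half p ≡ p Nat.+ 1) where
  open import Data.Integer using (+_; _+_; _*_; 0ℤ; 1ℤ)
  open import Data.Integer.Properties using (pos-+; pos-*)
  open import Data.Integer.Tactic.RingSolver using (solve-∀)
  open import Data.Nat.DivMod using (_%_; m*n%n≡0)
  open import Data.Nat.Divisibility using (∣-refl)
  open Residues p
  open PowersOfα p two-half using (h; α-power)
  open ≋-Reasoning

  H : ℤ
  H = + h

  two-H : + 2 * H ≋ 1ℤ
  two-H = begin
    + 2 * H            ≡⟨ pos-* 2 h ⟨
    + (2 Nat.* h)      ≡⟨ cong +_ two-half ⟩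
    + (p Nat.+ 1)      ≡⟨ pos-+ p 1 ⟩
    + p + 1ℤ           ≈⟨ +-zeroˡ-≋ (∣⇒≋0 ∣-refl) ⟩
    1ℤ                 ∎

  lucas-fib-ℤ : ∀ k → + L k + f k ≡ + 2 * f (suc k)
  lucas-fib-ℤ k = trans (sym (pos-+ (L k) (F k)))
    (trans (cong +_ (lucas-fib k)) (pos-* 2 (F (suc k))))

  halves⇒fib : ∀ k → H * + L k ≋ 1ℤ → H * f k ≋ 0ℤ → f k ≋ 0ℤ × f (suc k) ≋ 1ℤ
  halves⇒fib k HL≋1 HF≋0 = unit-cancel H (+ 2) two-H HF≋0 , (begin
    f (suc k)                ≡⟨ poly₁ (f (suc k)) ⟩
    1ℤ * f (suc k)           ≈⟨ *-cong (≋-sym two-H) ≋-refl ⟩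
    + 2 * H * f (suc k)      ≡⟨ poly₂ H (f (suc k)) ⟩
    H * (+ 2 * f (suc k))    ≡⟨ cong (H *_) (lucas-fib-ℤ k) ⟨
    H * (+ L k + f k)        ≡⟨ poly₃ H (+ L k) (f k) ⟩
    H * + L k + H * f k      ≈⟨ +-cong HL≋1 HF≋0 ⟩
    1ℤ                       ∎)
    where
    poly₁ : ∀ x → x ≡ 1ℤ * x
    poly₁ = solve-∀
    poly₂ : ∀ H x → + 2 * H * x ≡ H * (+ 2 * x)
    poly₂ = solve-∀
    poly₃ : ∀ H a b → H * (a + b) ≡ H * a + H * b
    poly₃ = solve-∀

  fib⇒halves : ∀ k → f k ≋ 0ℤ → f (suc k) ≋ 1ℤ → H * + L k ≋ 1ℤ × H * f k ≋ 0ℤ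
  fib⇒halves k F≋0 F′≋1 = HL≋1 , HF≋0
    where
    poly₁ : ∀ H → H * 0ℤ ≡ 0ℤ
    poly₁ = solve-∀
    poly₂ : ∀ H a b → H * b + H * a ≡ H * (a + b)
    poly₂ = solve-∀
    poly₃ : ∀ H x → H * (+ 2 * x) ≡ + 2 * H * x
    poly₃ = solve-∀
    HF≋0 : H * f k ≋ 0ℤ
    HF≋0 = ≋-trans (*-cong (≋-refl {H}) F≋0) (≡⇒≋ (poly₁ H))
    HL≋1 : H * + L k ≋ 1ℤ
    HL≋1 = begin
      H * + L k                ≈⟨ ≋-sym (+-zeroˡ-≋ HF≋0) ⟩
      H * f k + H * + L k      ≡⟨ poly₂ H (+ L k) (f k) ⟩
      H * (+ L k + f k)        ≡⟨ cong (H *_) (lucas-fib-ℤ k) ⟩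
      H * (+ 2 * f (suc k))    ≡⟨ poly₃ H (f (suc k)) ⟩
      + 2 * H * f (suc k)      ≈⟨ *-cong two-H F′≋1 ⟩
      1ℤ                       ∎

  α-power-one⇒ : ∀ n → pow p (α p) n ≡ one p
    → f (2 Nat.* n) ≋ 0ℤ × f (suc (2 Nat.* n)) ≋ 1ℤ
  α-power-one⇒ n αⁿ≡1 = halves⇒fib (2 Nat.* n)
    (halved (cong proj₁ coordinates))
    (halved (trans (cong proj₂ coordinates) (sym (m*n%n≡0 0 p))))
    where
    coordinates = trans (sym (α-power n)) αⁿ≡1
    halved : ∀ {x c} → (h Nat.* x) % p ≡ c % p → H * + x ≋ + c
    halved {x} e = ≋-trans (≡⇒≋ (sym (pos-* h x))) (%≡⇒≋ e)

  α-power-one⇐ : ∀ n → f (2 Nat.* n) ≋ 0ℤ → f (suc (2 Nat.* n)) ≋ 1ℤ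
    → pow p (α p) n ≡ one p
  α-power-one⇐ n F≋0 F′≋1 = trans (α-power n)
    (cong₂ _,_ (unhalved HL≋1) (trans (unhalved HF≋0) (m*n%n≡0 0 p)))
    where
    halves = fib⇒halves (2 Nat.* n) F≋0 F′≋1
    HL≋1 = proj₁ halves
    HF≋0 = proj₂ halves
    unhalved : ∀ {x c} → H * + x ≋ + c → (h Nat.* x) % p ≡ c % p
    unhalved {x} e = ≋⇒%≡ (≋-trans (≡⇒≋ (pos-* h x)) e)

module Arithmetic where
  open Nat using (_+_; _*_)
  open import Data.Nat.DivMod using (_%_; _/_; [m+kn]%n≡m%n; m*n/n≡m; m∣n⇒o%n%m≡o%m)
  open import Data.Nat.Divisibility using (_∣_; divides)
  open import Data.Nat.Properties using (+-suc; 1+n≢0; 0≢1+n; *-assoc; *-cancelˡ-≡)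
  open import Data.Nat.Tactic.RingSolver using (solve-∀)
  open import Data.Sum using (_⊎_; inj₁; inj₂)
  open ≡-Reasoning

  even-or-odd : ∀ n → (Σ ℕ λ t → n ≡ t + t) ⊎ (Σ ℕ λ t → n ≡ suc (t + t))
  even-or-odd zero = inj₁ (0 , refl)
  even-or-odd (suc n) with even-or-odd n
  ... | inj₁ (t , n≡t+t) = inj₂ (t , cong suc n≡t+t)
  ... | inj₂ (t , n≡1+t+t) = inj₁ (suc t , trans (cong suc n≡1+t+t) (cong suc (sym (+-suc t t))))

  two-half : ∀ {n} t → n ≡ suc (t + t) → 2 * half n ≡ n + 1
  two-half t refl = begin
    2 * ((suc (t + t) + 1) / 2)   ≡⟨ cong (λ x → 2 * (x / 2)) (poly₁ t) ⟩
    2 * (suc t * 2 / 2)           ≡⟨ cong (2 *_) (m*n/n≡m (suc t) 2) ⟩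
    2 * suc t                     ≡⟨ poly₂ t ⟩
    suc (t + t) + 1               ∎
    where
    poly₁ : ∀ t → suc (t + t) + 1 ≡ suc t * 2
    poly₁ = solve-∀
    poly₂ : ∀ t → 2 * suc t ≡ suc (t + t) + 1
    poly₂ = solve-∀

  halve-multiple : ∀ {n j z e m} → 2 * n ≡ j * z → e ∣ j → e * z ≡ 2 * m → m ∣ n
  halve-multiple {n} {j} {z} {e} {m} 2n≡jz (divides i j≡ie) ez≡2m =
    divides i (*-cancelˡ-≡ n (i * m) 2 (begin
      2 * n          ≡⟨ 2n≡jz ⟩
      j * z          ≡⟨ cong (_* z) j≡ie ⟩
      i * e * z      ≡⟨ *-assoc i e z ⟩
      i * (e * z)    ≡⟨ cong (i *_) ez≡2m ⟩
      i * (2 * m)    ≡⟨ poly i m ⟩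
      2 * (i * m)    ∎))
    where
    poly : ∀ i m → i * (2 * m) ≡ 2 * (i * m)
    poly = solve-∀

  mod-of : ∀ {a} r q n .{{_ : NonZero n}} → a ≡ r + q * n → a % n ≡ r % n
  mod-of r q n refl = [m+kn]%n≡m%n r q n

  Conclusion : ℕ → ℕ → Set
  Conclusion a z = (a % 2 ≡ 1 → z ≡ 2 * a) × (a % 4 ≡ 2 → z ≡ a / 2) × (a % 4 ≡ 0 → z ≡ a)

  mod2-of-mod4 : ∀ a {r} → a % 4 ≡ r → a % 2 ≡ r % 2
  mod2-of-mod4 a e = trans (sym (m∣n⇒o%n%m≡o%m 2 4 a (divides 2 refl))) (cong (_% 2) e)

  conclusion-odd : ∀ {a z} → a % 2 ≡ 1 → z ≡ 2 * a → Conclusion a z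
  conclusion-odd {a} odd z≡2a =
      (λ _ → z≡2a)
    , (λ a≡2 → ⊥-elim (1+n≢0 (trans (sym odd) (mod2-of-mod4 a a≡2))))
    , (λ a≡0 → ⊥-elim (1+n≢0 (trans (sym odd) (mod2-of-mod4 a a≡0))))

  conclusion-2mod4 : ∀ {a z} → a % 4 ≡ 2 → z ≡ a / 2 → Conclusion a z
  conclusion-2mod4 {a} a≡2 z≡a/2 =
      (λ odd → ⊥-elim (1+n≢0 (trans (sym odd) (mod2-of-mod4 a a≡2))))
    , (λ _ → z≡a/2)
    , (λ a≡0 → ⊥-elim (0≢1+n (trans (sym a≡0) a≡2)))

  conclusion-0mod4 : ∀ {a z} → a % 4 ≡ 0 → z ≡ a → Conclusion a z
  conclusion-0mod4 {a} a≡0 z≡a =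
      (λ odd → ⊥-elim (1+n≢0 (trans (sym odd) (mod2-of-mod4 a a≡0))))
    , (λ a≡2 → ⊥-elim (1+n≢0 (trans (sym a≡2) a≡0)))
    , (λ _ → z≡a)

open Arithmetic

module OddPrime (p : ℕ) .{{_ : NonZero p}} (p-prime : Prime p) (p≢2 : p ≢ 2) where
  open Nat using (nonTrivial⇒≢1; ≢-nonZero⁻¹; s<s)
  open import Data.Nat.Divisibility using (_∣_; divides)
  open import Data.Nat.Primality using (prime⇒irreducible; irreducible[2]; prime⇒nonTrivial; euclidsLemma)
  open import Data.Nat.Properties using (+-suc; +-identityʳ; *-identityˡ; m*n≢0; m<m+n)
  open import Data.Nat.DivMod using (m*n/n≡m)
  open import Data.Integer using (_+_; _*_; _-_; _^_; 0ℤ; 1ℤ; -1ℤ)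
  open import Data.Integer.Properties using (pos-+)
  open import Data.Sum using (inj₁; inj₂)
  import Data.Nat.Tactic.RingSolver as ℕ-Solver
  open import Data.Integer.Tactic.RingSolver using (solve-∀)
  open Periods using (least-positive-solution)

  p∤2 : ¬ p ∣ 2
  p∤2 d with irreducible[2] d
  ... | inj₁ p≡1 = nonTrivial⇒≢1 {{prime⇒nonTrivial p-prime}} p≡1
  ... | inj₂ p≡2 = p≢2 p≡2

  2∤p : ¬ 2 ∣ p
  2∤p d with prime⇒irreducible p-prime d
  ... | inj₁ ()
  ... | inj₂ 2≡p = p≢2 (sym 2≡p)

  p-odd : Σ ℕ λ t → p ≡ suc (t Nat.+ t)
  p-odd with even-or-odd p
  ... | inj₁ (t , p≡t+t) = ⊥-elim (2∤p (divides t (trans p≡t+t (double t))))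
    where
    double : ∀ t → t Nat.+ t ≡ t Nat.* 2
    double = ℕ-Solver.solve-∀
  ... | inj₂ odd = odd

  open Residues p
  open IdentityCriterion p (two-half (proj₁ p-odd) (proj₂ p-odd)) using (α-power-one⇒; α-power-one⇐)
  open ≋-Reasoning

  -1≉1 : ¬ -1ℤ ≋ 1ℤ
  -1≉1 e = p∤2 (≋0⇒∣ (+-cong (≋-sym e) (≋-refl {1ℤ})))

  -- z = Z p and c = F (z - 1).  Since F z ≡ 0, F (z + n) ≡ c F n, so the zeros of F
  -- modulo p repeat with period z, scaled by powers of the unit c.
  module Zeros (z′ : ℕ) (isZ : IsZ p (suc z′)) where
    z : ℕ
    z = suc z′

    c : ℤ
    c = f z′

    Fz≋0 : f z ≋ 0ℤ
    Fz≋0 = ∣⇒≋0 (proj₁ (proj₂ isZ))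

    shift : ∀ n → f (z Nat.+ n) ≋ c * f n
    shift n = begin
      f (suc (z′ Nat.+ n))          ≡⟨ f-add z′ n ⟩
      f z * f (suc n) + c * f n     ≈⟨ +-zeroˡ-≋ (*-zeroˡ-≋ Fz≋0) ⟩
      c * f n                       ∎

    iterate : ∀ j n → f (n Nat.+ j Nat.* z) ≋ c ^ j * f n
    iterate zero n = ≡⇒≋ (trans (cong f (+-identityʳ n)) (poly (f n)))
      where
      poly : ∀ x → x ≡ 1ℤ * x
      poly = solve-∀
    iterate (suc j) n = begin
      f (n Nat.+ (z Nat.+ j Nat.* z))   ≡⟨ cong f (rearrange n z (j Nat.* z)) ⟩
      f (z Nat.+ (n Nat.+ j Nat.* z))   ≈⟨ shift (n Nat.+ j Nat.* z) ⟩
      c * f (n Nat.+ j Nat.* z)         ≈⟨ *-cong (≋-refl {c}) (iterate j n) ⟩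
      c * (c ^ j * f n)                 ≡⟨ poly c (c ^ j) (f n) ⟩
      c * c ^ j * f n                   ∎
      where
      rearrange : ∀ n z m → n Nat.+ (z Nat.+ m) ≡ z Nat.+ (n Nat.+ m)
      rearrange = ℕ-Solver.solve-∀
      poly : ∀ a b x → a * (b * x) ≡ a * b * x
      poly = solve-∀

    -- Cassini at z - 1 with F z ≡ 0.
    c-squared : c * c ≋ -1ℤ ^ z
    c-squared = begin
      c * c                                              ≡⟨ poly (f z) c ⟩
      f z * (f z - c) + -1ℤ * (f z * f z - c * (f z + c)) ≡⟨ cong (λ t → f z * (f z - c) + -1ℤ * t) (cassini z′) ⟩
      f z * (f z - c) + -1ℤ * -1ℤ ^ z′                   ≈⟨ +-zeroˡ-≋ (*-zeroˡ-≋ Fz≋0) ⟩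
      -1ℤ ^ z                                            ∎
      where
      poly : ∀ a c → c * c ≡ a * (a - c) + -1ℤ * (a * a - c * (a + c))
      poly = solve-∀

    c-unit : c * -1ℤ ^ z * c ≋ 1ℤ
    c-unit = begin
      c * s * c       ≡⟨ poly c s ⟩
      c * c * s       ≈⟨ *-cong c-squared (≋-refl {s}) ⟩
      s * s           ≡⟨ sign-square z ⟩
      1ℤ              ∎
      where
      s = -1ℤ ^ z
      poly : ∀ c s → c * s * c ≡ c * c * s
      poly = solve-∀

    -- F (r + q z) ≡ c^q F r with c^q a unit, so the zeros of F are the multiples of z.
    zeros-are-multiples : ∀ n → p ∣ F n → z ∣ n
    zeros-are-multiples = Periods.multiples-of-period (λ n → p ∣ F n) z strip (proj₂ (proj₂ isZ))
      where
      strip : ∀ r q → p ∣ F (r Nat.+ q Nat.* z) → p ∣ F r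
      strip r q d = ≋0⇒∣ (unit-cancel (c ^ q) ((c * -1ℤ ^ z) ^ q)
        (unit-^ c (c * -1ℤ ^ z) q c-unit) (≋-trans (≋-sym (iterate q r)) (∣⇒≋0 d)))

    α-one⇒ : ∀ n → pow p (α p) n ≡ one p → Σ ℕ λ j → 2 Nat.* n ≡ j Nat.* z × c ^ j ≋ 1ℤ
    α-one⇒ n αⁿ≡1 = j , 2n≡jz , (begin
      c ^ j                     ≡⟨ poly (c ^ j) ⟩
      c ^ j * f 1               ≈⟨ ≋-sym (iterate j 1) ⟩
      f (suc (j Nat.* z))       ≡⟨ cong (f ∘ suc) 2n≡jz ⟨
      f (suc (2 Nat.* n))       ≈⟨ proj₂ F-values ⟩
      1ℤ                        ∎)
      where
      F-values = α-power-one⇒ n αⁿ≡1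
      z∣2n : z ∣ 2 Nat.* n
      z∣2n = zeros-are-multiples (2 Nat.* n) (≋0⇒∣ (proj₁ F-values))
      j = _∣_.quotient z∣2n
      2n≡jz : 2 Nat.* n ≡ j Nat.* z
      2n≡jz = _∣_.equality z∣2n
      poly : ∀ x → x ≡ x * 1ℤ
      poly = solve-∀

    α-one⇐ : ∀ n j → 2 Nat.* n ≡ j Nat.* z → c ^ j ≋ 1ℤ → pow p (α p) n ≡ one p
    α-one⇐ n j 2n≡jz cʲ≋1 = α-power-one⇐ n F≋0 F′≋1
      where
      poly₀ : ∀ x → x * 0ℤ ≡ 0ℤ
      poly₀ = solve-∀
      poly₁ : ∀ x → x * 1ℤ ≡ x
      poly₁ = solve-∀
      F≋0 : f (2 Nat.* n) ≋ 0ℤ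
      F≋0 = begin
        f (2 Nat.* n)           ≡⟨ cong f 2n≡jz ⟩
        f (0 Nat.+ j Nat.* z)   ≈⟨ iterate j 0 ⟩
        c ^ j * 0ℤ              ≡⟨ poly₀ (c ^ j) ⟩
        0ℤ                      ∎
      F′≋1 : f (suc (2 Nat.* n)) ≋ 1ℤ
      F′≋1 = begin
        f (suc (2 Nat.* n))     ≡⟨ cong (f ∘ suc) 2n≡jz ⟩
        f (1 Nat.+ j Nat.* z)   ≈⟨ iterate j 1 ⟩
        c ^ j * 1ℤ              ≡⟨ poly₁ (c ^ j) ⟩
        c ^ j                   ≈⟨ cʲ≋1 ⟩
        1ℤ                      ∎

    order-of-α : ∀ e m .{{_ : NonZero e}} → e Nat.* z ≡ 2 Nat.* m → c ^ e ≋ 1ℤ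
      → (∀ r → 0 < r → r < e → ¬ c ^ r ≋ 1ℤ) → ∀ a → IsOrder p a → a ≡ m
    order-of-α e m ez≡2m cᵉ≋1 gap a (a>0 , αᵃ≡1 , minimal) =
      least-positive-solution (λ n → pow p (α p) n ≡ one p) m (positive m ez≡2m)
        (α-one⇐ m e (sym ez≡2m) cᵉ≋1) multiple a a>0 αᵃ≡1 minimal
      where
      positive : ∀ m → e Nat.* z ≡ 2 Nat.* m → 0 < m
      positive zero ez≡0 = ⊥-elim (≢-nonZero⁻¹ (e Nat.* z) {{m*n≢0 e z}} ez≡0)
      positive (suc m) _ = z<s
      multiple : ∀ n → pow p (α p) n ≡ one p → m ∣ n
      multiple n αⁿ≡1 = halve-multiple 2n≡jz (order-divides c e cᵉ≋1 gap j cʲ≋1) ez≡2m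
        where
        solution = α-one⇒ n αⁿ≡1
        j = proj₁ solution
        2n≡jz = proj₁ (proj₂ solution)
        cʲ≋1 = proj₂ (proj₂ solution)

    -- z odd: c² ≡ -1, so c has order 4 and α has order 2z.
    order-if-z-odd : ∀ k → z ≡ suc (k Nat.+ k) → ∀ a → IsOrder p a → a ≡ z Nat.* 2
    order-if-z-odd k z-odd = order-of-α 4 (z Nat.* 2) (four-z z) c⁴≋1 gap
      where
      four-z : ∀ z → 4 Nat.* z ≡ 2 Nat.* (z Nat.* 2)
      four-z = ℕ-Solver.solve-∀
      poly₁ : ∀ c → c ≡ c * 1ℤ
      poly₁ = solve-∀
      poly₄ : ∀ c → c * (c * (c * (c * 1ℤ))) ≡ (c * c) * (c * c)
      poly₄ = solve-∀
      c²≋-1 : c * c ≋ -1ℤ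
      c²≋-1 = ≋-trans c-squared (≡⇒≋ (trans (cong (-1ℤ ^_) z-odd) (sign-odd k)))
      c⁴≋1 : c ^ 4 ≋ 1ℤ
      c⁴≋1 = ≋-trans (≡⇒≋ (poly₄ c)) (*-cong c²≋-1 c²≋-1)
      c≉1 : ¬ c ≋ 1ℤ
      c≉1 c≋1 = -1≉1 (≋-trans (≋-sym c²≋-1) (*-cong c≋1 c≋1))
      gap : ∀ r → 0 < r → r < 4 → ¬ c ^ r ≋ 1ℤ
      gap 1 _ _ c¹≋1 = c≉1 (≋-trans (≡⇒≋ (poly₁ c)) c¹≋1)
      gap 2 _ _ c²≋1 = -1≉1 (≋-trans (≋-sym c²≋-1) (≋-trans (≡⇒≋ (cong (c *_) (poly₁ c))) c²≋1))
      gap 3 _ _ c³≋1 = c≉1 (begin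
        c             ≡⟨ poly₁ c ⟩
        c * 1ℤ        ≈⟨ *-cong (≋-refl {c}) (≋-sym c³≋1) ⟩
        c ^ 4         ≈⟨ c⁴≋1 ⟩
        1ℤ            ∎)
      gap (suc (suc (suc (suc _)))) _ (s<s (s<s (s<s (s<s ()))))

    -- z = 2k: p divides F z = F k L k but not F k, so L k = F (k - 1) + F (k + 1) ≡ 0
    -- and c ≡ F (z + 1) = F (k + 1)² + F k² ≡ F k² - F (k - 1) F (k + 1) = (-1)ᵏ⁻¹.
    c-if-z-even : ∀ k′ → z ≡ suc k′ Nat.+ suc k′ → c ≋ -1ℤ ^ k′
    c-if-z-even k′ z-even = begin
      c                                ≈⟨ ≋-sym (+-zeroˡ-≋ Fz≋0) ⟩
      f z + c                          ≡⟨ cong (f ∘ suc) z-even ⟩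
      f (suc (k Nat.+ k))              ≡⟨ f-add k k ⟩
      w * w + u * u                    ≡⟨ poly u v w ⟩
      (v + w) * w + (u * u - v * w)    ≈⟨ +-zeroˡ-≋ (*-zeroˡ-≋ Lk≋0) ⟩
      u * u - v * w                    ≡⟨ cassini k′ ⟩
      -1ℤ ^ k′                         ∎
      where
      k = suc k′
      u = f k
      v = f k′
      w = f (suc k)
      poly : ∀ u v w → w * w + u * u ≡ (v + w) * w + (u * u - v * w)
      poly = solve-∀
      k<z : k < z
      k<z = subst (k <_) (sym z-even) (m<m+n k z<s)
      p∣Lk : p ∣ L k
      p∣Lk with euclidsLemma (F k) (L k) p-prime
                  (subst (p ∣_) (trans (cong F z-even) (fib-double k)) (proj₁ (proj₂ isZ)))
      ... | inj₁ p∣Fk = ⊥-elim (proj₂ (proj₂ isZ) k z<s k<z p∣Fk)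
      ... | inj₂ p∣Lk = p∣Lk
      Lk≋0 : v + w ≋ 0ℤ
      Lk≋0 = ≋-trans (≡⇒≋ (sym (pos-+ (F k′) (F (suc k))))) (∣⇒≋0 p∣Lk)

    -- z = 2k with k odd: c ≡ 1 has order 1 and α has order k.
    order-if-k-odd : ∀ k′ s → z ≡ suc k′ Nat.+ suc k′ → k′ ≡ s Nat.+ s
      → ∀ a → IsOrder p a → a ≡ suc k′
    order-if-k-odd k′ s z-even k′-even =
      order-of-α 1 (suc k′) (trans (*-identityˡ z) (trans z-even (double (suc k′)))) c¹≋1 gap
      where
      double : ∀ k → k Nat.+ k ≡ 2 Nat.* k
      double = ℕ-Solver.solve-∀
      poly : ∀ c → c * 1ℤ ≡ c
      poly = solve-∀
      c¹≋1 : c ^ 1 ≋ 1ℤ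
      c¹≋1 = ≋-trans (≡⇒≋ (poly c))
        (≋-trans (c-if-z-even k′ z-even) (≡⇒≋ (trans (cong (-1ℤ ^_) k′-even) (sign-even s))))
      gap : ∀ r → 0 < r → r < 1 → ¬ c ^ r ≋ 1ℤ
      gap (suc _) _ (s<s ())

    -- z = 2k with k even: c ≡ -1 has order 2 and α has order z.
    order-if-k-even : ∀ k′ s → z ≡ suc k′ Nat.+ suc k′ → k′ ≡ suc (s Nat.+ s)
      → ∀ a → IsOrder p a → a ≡ z
    order-if-k-even k′ s z-even k′-odd = order-of-α 2 z refl c²≋1 gap
      where
      poly : ∀ c → c * 1ℤ ≡ c
      poly = solve-∀
      c≋-1 : c ≋ -1ℤ
      c≋-1 = ≋-trans (c-if-z-even k′ z-even) (≡⇒≋ (trans (cong (-1ℤ ^_) k′-odd) (sign-odd s)))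
      c²≋1 : c ^ 2 ≋ 1ℤ
      c²≋1 = ^-cong 2 c≋-1
      gap : ∀ r → 0 < r → r < 2 → ¬ c ^ r ≋ 1ℤ
      gap 1 _ _ c¹≋1 = -1≉1 (≋-trans (≋-sym c≋-1) (≋-trans (≡⇒≋ (sym (poly c))) c¹≋1))
      gap (suc (suc _)) _ (s<s (s<s ()))

    even-form : ∀ {k′} → z′ ≡ suc (k′ Nat.+ k′) → z ≡ suc k′ Nat.+ suc k′
    even-form {k′} z′-odd = cong suc (trans z′-odd (sym (+-suc k′ k′)))

    conclusion : ∀ a → IsOrder p a → Conclusion a z
    conclusion a isOrder with even-or-odd z′
    ... | inj₁ (k , z′≡k+k) = conclusion-2mod4
      (mod-of 2 k 4 (trans (trans a≡2z (cong (Nat._* 2) z-odd)) (twice-odd k)))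
      (sym (trans (cong (Nat._/ 2) a≡2z) (m*n/n≡m z 2)))
      where
      z-odd = cong suc z′≡k+k
      a≡2z = order-if-z-odd k z-odd a isOrder
      twice-odd : ∀ k → suc (k Nat.+ k) Nat.* 2 ≡ 2 Nat.+ k Nat.* 4
      twice-odd = ℕ-Solver.solve-∀
    ... | inj₂ (k′ , z′≡1+k′+k′) with even-or-odd k′
    ...   | inj₁ (s , k′≡s+s) = conclusion-odd
      (mod-of 1 s 2 (trans a≡k (cong suc (trans k′≡s+s (double-right s)))))
      (trans (even-form z′≡1+k′+k′) (trans (double-left (suc k′)) (cong (2 Nat.*_) (sym a≡k))))
      where
      a≡k = order-if-k-odd k′ s (even-form z′≡1+k′+k′) k′≡s+s a isOrder
      double-right : ∀ k → k Nat.+ k ≡ k Nat.* 2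
      double-right = ℕ-Solver.solve-∀
      double-left : ∀ k → k Nat.+ k ≡ 2 Nat.* k
      double-left = ℕ-Solver.solve-∀
    ...   | inj₂ (s , k′≡1+s+s) = conclusion-0mod4
      (mod-of 0 (suc s) 4 (trans a≡z (trans (even-form z′≡1+k′+k′)
        (trans (cong (λ t → suc t Nat.+ suc t) k′≡1+s+s) (quadruple s)))))
      (sym a≡z)
      where
      a≡z = order-if-k-even k′ s (even-form z′≡1+k′+k′) k′≡1+s+s a isOrder
      quadruple : ∀ s → suc (suc (s Nat.+ s)) Nat.+ suc (suc (s Nat.+ s)) ≡ 0 Nat.+ suc s Nat.* 4
      quadruple = ℕ-Solver.solve-∀

open Nat using (_*_)
open import Data.Nat.DivMod using (_%_; _/_)

mainTheorem7 : (p : ℕ) → .{{_ : NonZero p}} → Prime p → p ≢ 2 → p ≢ 5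
    → (a z : ℕ) → IsOrder p a → IsZ p z
    → ((a % 2 ≡ 1 → z ≡ 2 * a) × (a % 4 ≡ 2 → z ≡ a / 2) × (a % 4 ≡ 0 → z ≡ a))
mainTheorem7 p p-prime p≢2 _ a zero _ (() , _)
mainTheorem7 p p-prime p≢2 _ a (suc z′) isOrder isZ =
  OddPrime.Zeros.conclusion p p-prime p≢2 z′ isZ a isOrder
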